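{- Let $k$ be a positive integer and let $G_k$ be a graph that has no packing $(1^2,2^k)$-coloring but every proper subgraph of which has a packing $(1^2,2^k)$-coloring. Let $u$ be a vertex of degree $3$ in $G_k$ with neighbors $u_1,u_2,v_3$, where $u_1$ and $u_2$ have degree $2$, and for $i\in\{1,2\}$ let $v_i$ be the neighbor of $u_i$ other than $u$. Then $v_3$ has degree at least $k+1$, and at least one of $v_1,v_2,v_3$ has degree at least $k+2$.
   Context: All graphs are finite and simple. A set of vertices is $i$-independent if any two distinct vertices in it are at distance at least $i+1$. A packing $(1^{\ell},2^{k})$-coloring of $G$ is a partition of $V(G)$ into $\ell$ independent sets and $k$ $2$-independent sets (some parts may be empty). -}

module Defs where

open import Data.Nat using (ℕ; _+_; _<_)
open import Data.Bool using (Bool; true; false)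
open import Data.Fin using (Fin; toℕ)
open import Data.List using (length; filterᵇ; allFin)
open import Data.Product using (Σ; ∃; ∃-syntax; _×_; _,_)
open import Data.Sum using (_⊎_)
open import Relation.Binary.PropositionalEquality using (_≡_; _≢_)
open import Relation.Nullary using (¬_)
open import Function.Definitions using (Injective)

record Graph : Set where
  field
    n      : ℕ
    adj    : Fin n → Fin n → Bool
    sym    : ∀ x y → adj x y ≡ adj y x
    irrefl : ∀ x → adj x x ≡ false
open Graph public

Adj : (G : Graph) → Fin (n G) → Fin (n G) → Set
Adj G x y = adj G x y ≡ true

deg : (G : Graph) → Fin (n G) → ℕ
deg G x = length (filterᵇ (adj G x) (allFin (n G)))

-- a set S (given by membership) is independent (1-independent):
-- distinct members are at distance ≥ 2, i.e. non-adjacent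
-- 2-independent: distinct members at distance ≥ 3, i.e. non-adjacent and no common neighbour
Indep1 : (G : Graph) → (Fin (n G) → Set) → Set
Indep1 G S = ∀ x y → S x → S y → x ≢ y → ¬ Adj G x y

Indep2 : (G : Graph) → (Fin (n G) → Set) → Set
Indep2 G S = ∀ x y → S x → S y → x ≢ y →
  ¬ Adj G x y × (∀ z → ¬ (Adj G x z × Adj G z y))

PackingColoring : ℕ → ℕ → Graph → Set
PackingColoring ℓ k G =
  Σ (Fin (n G) → Fin (ℓ + k)) λ c →
    ∀ (i : Fin (ℓ + k)) →
      (toℕ i < ℓ → Indep1 G (λ x → c x ≡ i)) ×
      (¬ (toℕ i < ℓ) → Indep2 G (λ x → c x ≡ i))

record Subgraph (H G : Graph) : Set where
  field
    f     : Fin (n H) → Fin (n G)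
    inj   : Injective _≡_ _≡_ f
    hom   : ∀ x y → Adj H x y → Adj G (f x) (f y)
    proper : (n H < n G) ⊎ (∃[ x ] ∃[ y ] (Adj G (f x) (f y) × adj H x y ≡ false))

Critical : ℕ → ℕ → Graph → Set
Critical ℓ k G = ¬ PackingColoring ℓ k G × (∀ H → Subgraph H G → PackingColoring ℓ k H)

-- Delete u, u₁, u₂ from G; by criticality the rest H has a packing (1²,2ᵏ)-colouring φ, and we show
-- that small degrees at v₁, v₂, v₃ would let φ extend to G. The extension first recolours v₃ (or v₁)
-- with an independent colour missing from its H-neighbourhood, if there is one, and then gives u, u₁, u₂
-- independent colours or a 2-independent colour missing around v₃ or v₁. Such a colour exists by counting:
-- an H-neighbourhood of at most k vertices (fewer than k for the first claim) that already uses an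
-- independent colour cannot use all k 2-independent ones. The positions v₁ = u₂ (a triangle), v₁ = v₃
-- and v₂ = v₃ are treated separately, and the situation at u₂ is the mirror image of that at u₁.
module Submission where

open import Defs
open import Data.Nat using (ℕ; zero; suc; _+_; _≤_; _<_; _≥_; z≤n; s≤s; s≤s⁻¹; _≤?_; _<?_)
open import Data.Nat.Properties using (≤-trans; n≤1+n; +-comm; ≰⇒>; <⇒≱; <⇒≤; <-irrefl)
open import Data.Fin using (Fin; zero; suc; toℕ; fromℕ<; _≟_)
open import Data.Bool using (Bool; true; false; _∧_; T?)
open import Data.Bool.Properties using (∧-conicalˡ; ∧-conicalʳ; ∧-comm; ∧-zeroʳ; T-≡)
open import Function.Bundles using (Equivalence)
open import Data.List using (List; []; _∷_; length; filterᵇ; allFin; map; _++_)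
open import Data.List.Properties using (length-map; length-++; length-tabulate)
open import Data.List.Membership.Propositional using (_∈_; _∉_; find; lose)
open import Data.List.Membership.Propositional.Properties
  using (∈-filter⁺; ∈-filter⁻; ∈-allFin; ∈-map⁺; ∈-map⁻; ∈-++⁺ˡ; ∈-++⁺ʳ; ∈-++⁻)
import Data.List.Membership.DecPropositional as DecMembership
open import Data.List.Relation.Unary.Any using (here; there; any?)
open import Data.List.Relation.Unary.All using (All; []; _∷_)
import Data.List.Relation.Unary.All as All
open import Data.List.Relation.Unary.AllPairs using ([]; _∷_)
open import Data.List.Relation.Unary.Unique.Propositional using (Unique)
import Data.List.Relation.Unary.Unique.Propositional.Properties as Unique
open import Data.List.Relation.Binary.Subset.Propositional using (_⊆_)
open import Data.List.Relation.Binary.Disjoint.Propositional using (Disjoint)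
open import Data.List.Relation.Binary.Permutation.Propositional using (_↭_)
import Data.List.Relation.Binary.Permutation.Propositional as ↭
open import Data.List.Relation.Binary.Permutation.Propositional.Properties using (∈-resp-↭)
open import Data.Product using (Σ; _×_; _,_; proj₁; proj₂)
open import Data.Sum using (_⊎_; inj₁; inj₂)
open import Data.Empty using (⊥; ⊥-elim)
open import Data.Unit using (⊤; tt)
open import Function using (_∘_; const)
open import Data.Vec.Functional using (updateAt)
open import Data.Vec.Functional.Properties using (updateAt-updates; updateAt-minimal)
open import Relation.Nullary using (¬_; Dec; yes; no; ¬?)
open import Relation.Nullary.Decidable using (isNo; _⊎-dec_; decidable-stable)
open import Relation.Binary.Definitions using (DecidableEquality)
open import Relation.Binary.PropositionalEquality
  using (_≡_; _≢_; refl; trans; cong; cong₂; subst; ≢-sym)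
  renaming (sym to ≡-sym)

≡-≢-trans : ∀ {A : Set} {a b c : A} → a ≡ b → b ≢ c → a ≢ c
≡-≢-trans refl b≢c = b≢c

≰⇒≤ : ∀ {k d} c → ¬ k + suc c ≤ d → d ≤ c + k
≰⇒≤ {k} {d} c k+1+c≰d = s≤s⁻¹ (subst (suc d ≤_) (+-comm k (suc c)) (≰⇒> k+1+c≰d))

module _ {A : Set} (_≟ᴬ_ : DecidableEquality A) where

  removeFirst : A → List A → List A
  removeFirst x [] = []
  removeFirst x (y ∷ ys) with x ≟ᴬ y
  ... | yes _ = ys
  ... | no _ = y ∷ removeFirst x ys

  length-removeFirst : ∀ {x} ys → x ∈ ys → suc (length (removeFirst x ys)) ≡ length ys
  length-removeFirst {x} (y ∷ ys) x∈ with x ≟ᴬ y | x∈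
  ... | yes _ | _ = refl
  ... | no x≢y | here x≡y = ⊥-elim (x≢y x≡y)
  ... | no _ | there x∈ys = cong suc (length-removeFirst ys x∈ys)

  ∈-removeFirst : ∀ {x z} ys → z ∈ ys → z ≢ x → z ∈ removeFirst x ys
  ∈-removeFirst {x} (y ∷ ys) z∈ z≢x with x ≟ᴬ y | z∈
  ... | yes refl | here refl = ⊥-elim (z≢x refl)
  ... | yes refl | there z∈ys = z∈ys
  ... | no _ | here z≡y = here z≡y
  ... | no _ | there z∈ys = there (∈-removeFirst ys z∈ys z≢x)

  length-≤-⊆ : ∀ {xs ys} → Unique xs → xs ⊆ ys → length xs ≤ length ys
  length-≤-⊆ {[]} _ _ = z≤n
  length-≤-⊆ {x ∷ xs} {ys} (x∉xs ∷ xs!) xs⊆ys =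
    subst (suc (length xs) ≤_) (length-removeFirst ys (xs⊆ys (here refl)))
      (s≤s (length-≤-⊆ xs! λ z∈xs →
        ∈-removeFirst ys (xs⊆ys (there z∈xs)) (≢-sym (All.lookup x∉xs z∈xs))))

∈-filterᵇ-allFin : ∀ {m} (p : Fin m → Bool) {x} → p x ≡ true → x ∈ filterᵇ p (allFin m)
∈-filterᵇ-allFin p {x} px = ∈-filter⁺ (T? ∘ p) (∈-allFin x) (Equivalence.from T-≡ px)

∈-filterᵇ⇒true : ∀ {A : Set} (p : A → Bool) {x} xs → x ∈ filterᵇ p xs → p x ≡ true
∈-filterᵇ⇒true p xs x∈ = Equivalence.to T-≡ (proj₂ (∈-filter⁻ (T? ∘ p) {xs = xs} x∈))

Colour : ℕ → Set
Colour k = Fin (2 + k)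

IsOne : ∀ {k} → Colour k → Set
IsOne zero = ⊤
IsOne (suc zero) = ⊤
IsOne (suc (suc _)) = ⊥

IsTwo : ∀ {k} → Colour k → Set
IsTwo zero = ⊥
IsTwo (suc zero) = ⊥
IsTwo (suc (suc _)) = ⊤

module _ {k : ℕ} where

  isOne⇒¬isTwo : {c : Colour k} → IsOne c → ¬ IsTwo c
  isOne⇒¬isTwo {suc (suc _)} ()

  isOne-isTwo-≢ : {c d : Colour k} → IsOne c → IsTwo d → c ≢ d
  isOne-isTwo-≢ c₁ d₂ refl = isOne⇒¬isTwo c₁ d₂

  isTwo-isOne-≢ : {c d : Colour k} → IsTwo c → IsOne d → c ≢ d
  isTwo-isOne-≢ c₂ d₁ = ≢-sym (isOne-isTwo-≢ d₁ c₂)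

  isTwo⇒toℕ≮2 : {c : Colour k} → IsTwo c → ¬ toℕ c < 2
  isTwo⇒toℕ≮2 {suc (suc _)} _ (s≤s (s≤s ()))

  toℕ≮2⇒isTwo : (c : Colour k) → ¬ toℕ c < 2 → IsTwo c
  toℕ≮2⇒isTwo zero c≮2 = c≮2 (s≤s z≤n)
  toℕ≮2⇒isTwo (suc zero) c≮2 = c≮2 (s≤s (s≤s z≤n))
  toℕ≮2⇒isTwo (suc (suc _)) _ = tt

  opp : Colour k → Colour k
  opp zero = suc zero
  opp _ = zero

  opp-isOne : (c : Colour k) → IsOne (opp c)
  opp-isOne zero = tt
  opp-isOne (suc zero) = tt
  opp-isOne (suc (suc _)) = tt

  ≢-opp : (c : Colour k) → c ≢ opp c
  ≢-opp zero ()
  ≢-opp (suc zero) ()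
  ≢-opp (suc (suc _)) ()

  avoidOne⊎bothOne : (a b : Colour k) →
    (Σ (Colour k) λ x → IsOne x × a ≢ x × b ≢ x) ⊎ (IsOne a × IsOne b)
  avoidOne⊎bothOne zero zero = inj₁ (suc zero , tt , (λ ()) , (λ ()))
  avoidOne⊎bothOne zero (suc zero) = inj₂ (tt , tt)
  avoidOne⊎bothOne zero (suc (suc _)) = inj₁ (suc zero , tt , (λ ()) , (λ ()))
  avoidOne⊎bothOne (suc zero) zero = inj₂ (tt , tt)
  avoidOne⊎bothOne (suc zero) (suc zero) = inj₁ (zero , tt , (λ ()) , (λ ()))
  avoidOne⊎bothOne (suc zero) (suc (suc _)) = inj₁ (zero , tt , (λ ()) , (λ ()))
  avoidOne⊎bothOne (suc (suc _)) zero = inj₁ (suc zero , tt , (λ ()) , (λ ()))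
  avoidOne⊎bothOne (suc (suc _)) (suc zero) = inj₁ (zero , tt , (λ ()) , (λ ()))
  avoidOne⊎bothOne (suc (suc _)) (suc (suc _)) = inj₁ (zero , tt , (λ ()) , (λ ()))

  ≢0∧≢1⇒isTwo : (c : Colour k) → c ≢ zero → c ≢ suc zero → IsTwo c
  ≢0∧≢1⇒isTwo zero c≢0 _ = c≢0 refl
  ≢0∧≢1⇒isTwo (suc zero) _ c≢1 = c≢1 refl
  ≢0∧≢1⇒isTwo (suc (suc _)) _ _ = tt

  missing-isOne⊎both∈ : (cs : List (Colour k)) →
    (Σ (Colour k) λ x → IsOne x × x ∉ cs) ⊎ (zero ∈ cs × suc zero ∈ cs)
  missing-isOne⊎both∈ cs with zero ∈? cs | suc zero ∈? cs
    where open DecMembership _≟_ using (_∈?_)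
  ... | no 0∉ | _ = inj₁ (zero , tt , 0∉)
  ... | yes _ | no 1∉ = inj₁ (suc zero , tt , 1∉)
  ... | yes 0∈ | yes 1∈ = inj₂ (0∈ , 1∈)

  twoColour : Fin k → Colour k
  twoColour i = suc (suc i)

  twoColours : List (Colour k)
  twoColours = map twoColour (allFin k)

  twoColours-unique : Unique twoColours
  twoColours-unique = Unique.map⁺ twoColour-injective (Unique.allFin⁺ k)
    where
    twoColour-injective : ∀ {i j} → twoColour i ≡ twoColour j → i ≡ j
    twoColour-injective refl = refl

  ∈-twoColours⇒isTwo : ∀ {d} → d ∈ twoColours → IsTwo d
  ∈-twoColours⇒isTwo d∈ with ∈-map⁻ twoColour d∈
  ... | _ , _ , refl = tt

  length-twoColours : length twoColours ≡ k
  length-twoColours = trans (length-map _ (allFin k)) (length-tabulate _)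

  missing-isTwo : (ones cs : List (Colour k)) → Unique ones → All IsOne ones → ones ⊆ cs →
    length cs < length ones + k → Σ (Colour k) λ d → IsTwo d × d ∉ cs
  missing-isTwo ones cs ones! ones₁ ones⊆cs short
    with any? (λ d → ¬? (d ∈? cs)) twoColours
    where open DecMembership _≟_ using (_∈?_)
  ... | yes some-missing with find some-missing
  ...   | d , d∈ , d∉cs = d , ∈-twoColours⇒isTwo d∈ , d∉cs
  missing-isTwo ones cs ones! ones₁ ones⊆cs short | no none-missing =
    ⊥-elim (<⇒≱ short (subst (_≤ length cs) length-ones++twos
      (length-≤-⊆ _≟_ (Unique.++⁺ ones! twoColours-unique disjoint) ones++twos⊆cs)))
    where
    open DecMembership _≟_ using (_∈?_)
    disjoint : Disjoint ones twoColours
    disjoint (c∈ones , c∈twos) =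
      isOne⇒¬isTwo (All.lookup ones₁ c∈ones) (∈-twoColours⇒isTwo c∈twos)
    twos⊆cs : twoColours ⊆ cs
    twos⊆cs {d} d∈ with d ∈? cs
    ... | yes d∈cs = d∈cs
    ... | no d∉cs = ⊥-elim (none-missing (lose d∈ d∉cs))
    ones++twos⊆cs : (ones ++ twoColours) ⊆ cs
    ones++twos⊆cs c∈ with ∈-++⁻ ones c∈
    ... | inj₁ c∈ones = ones⊆cs c∈ones
    ... | inj₂ c∈twos = twos⊆cs c∈twos
    length-ones++twos : length (ones ++ twoColours) ≡ length ones + k
    length-ones++twos = trans (length-++ ones) (cong (length ones +_) length-twoColours)

module _ {V : Set} {k : ℕ} where

  Separated : (V → V → Set) → (V → Colour k) → V → V → Set
  Separated R c x y = ¬ R x y × (IsTwo (c x) → ∀ z → R x z → R z y → ⊥)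

  IsPacking : (V → V → Set) → (V → Colour k) → Set
  IsPacking R c = ∀ x y → x ≢ y → c x ≡ c y → Separated R c x y

Separated-sym : ∀ {V : Set} {k} {R : V → V → Set} {c : V → Colour k} → (∀ {a b} → R a b → R b a) →
  ∀ {x y} → c x ≡ c y → Separated R c x y → Separated R c y x
Separated-sym R-sym same (x≁y , no-common) =
  x≁y ∘ R-sym , λ y₂ z yz zx → no-common (subst IsTwo (≡-sym same) y₂) z (R-sym zx) (R-sym yz)

isPacking⇒packingColoring : ∀ {k} G (c : Fin (n G) → Colour k) → IsPacking (Adj G) c →
  PackingColoring 2 k G
isPacking⇒packingColoring G c packing = c , λ i →
  (λ _ x y x∈i y∈i x≢y → proj₁ (packing x y x≢y (trans x∈i (≡-sym y∈i)))) ,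
  (λ i≮2 x y x∈i y∈i x≢y →
    let (x≁y , no-common) = packing x y x≢y (trans x∈i (≡-sym y∈i))
    in x≁y , λ z (xz , zy) → no-common (subst IsTwo (≡-sym x∈i) (toℕ≮2⇒isTwo i i≮2)) z xz zy)

packingColoring⇒isPacking : ∀ {k} G ((c , classes) : PackingColoring 2 k G) → IsPacking (Adj G) c
packingColoring⇒isPacking G (c , classes) x y x≢y cx≡cy with toℕ (c x) <? 2
... | yes cx<2 = proj₁ (classes (c x)) cx<2 x y refl (≡-sym cx≡cy) x≢y ,
                 λ cx₂ → ⊥-elim (isTwo⇒toℕ≮2 cx₂ cx<2)
... | no cx≮2 =
  let (x≁y , no-common) = proj₂ (classes (c x)) cx≮2 x y refl (≡-sym cx≡cy) x≢y
  in x≁y , λ _ z xz zy → no-common z (xz , zy)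

module _ {m : ℕ} {A : Set} where

  _[_≔_] : (Fin m → A) → Fin m → A → Fin m → A
  φ [ w ≔ x ] = updateAt φ w (const x)

  ≔-same : ∀ φ w {x} → (φ [ w ≔ x ]) w ≡ x
  ≔-same φ w = updateAt-updates w φ

  ≔-other : ∀ φ {w x y} → y ≢ w → (φ [ w ≔ x ]) y ≡ φ y
  ≔-other φ {w} {y = y} y≢w = updateAt-minimal y w φ y≢w

module _ {m k : ℕ} (R : Fin m → Fin m → Set) (R-sym : ∀ {x y} → R x y → R y x) where

  -- an independent colour only has to avoid the neighbours
  recolour-isPacking : ∀ {φ : Fin m → Colour k} → IsPacking R φ → ∀ w {x} → IsOne x →
    (∀ y → R w y → φ y ≢ x) → IsPacking R (φ [ w ≔ x ])
  recolour-isPacking {φ} packing w {x} x₁ x∉N[w] a b a≢b same with a ≟ w | b ≟ w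
  ... | yes refl | yes refl = ⊥-elim (a≢b refl)
  ... | yes refl | no b≢w =
    (λ wb → x∉N[w] b wb (trans (≡-sym (trans same (≔-other φ b≢w))) (≔-same φ w))) ,
    (λ x₂ → ⊥-elim (isOne⇒¬isTwo x₁ (subst IsTwo (≔-same φ w) x₂)))
  ... | no a≢w | yes refl =
    (λ aw → x∉N[w] a (R-sym aw) (trans (≡-sym (≔-other φ a≢w)) (trans same (≔-same φ w)))) ,
    (λ x₂ → ⊥-elim (isOne⇒¬isTwo x₁ (subst IsTwo (trans same (≔-same φ w)) x₂)))
  ... | no a≢w | no b≢w =
    let (a≁b , no-common) = packing a b a≢b (trans (≡-sym (≔-other φ a≢w)) (trans same (≔-other φ b≢w)))
    in a≁b , λ a₂ → no-common (subst IsTwo (≔-other φ a≢w) a₂)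

Adj-sym : ∀ G {x y} → Adj G x y → Adj G y x
Adj-sym G {x} {y} xy = trans (Graph.sym G y x) xy

Adj⇒≢ : ∀ G {x y} → Adj G x y → x ≢ y
Adj⇒≢ G {x} xx refl with trans (≡-sym xx) (Graph.irrefl G x)
... | ()

neighbours : (G : Graph) → Fin (n G) → List (Fin (n G))
neighbours G w = filterᵇ (adj G w) (allFin (n G))

module _ (G : Graph) where
  open DecMembership (_≟_ {n G}) using (_∈?_)

  neighbours-of-degree : ∀ {w} xs → deg G w ≡ length xs → Unique xs → All (Adj G w) xs →
    ∀ {y} → Adj G w y → y ∈ xs
  neighbours-of-degree {w} xs deg≡ xs! xs-adj {y} wy with y ∈? xs
  ... | yes y∈xs = y∈xs
  ... | no y∉xs = ⊥-elim (<-irrefl (≡-sym deg≡) (length-≤-⊆ _≟_ (y≢xs ∷ xs!) y∷xs⊆))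
    where
    y≢xs : All (y ≢_) xs
    y≢xs = All.tabulate λ { z∈ refl → y∉xs z∈ }
    y∷xs⊆ : (y ∷ xs) ⊆ neighbours G w
    y∷xs⊆ (here refl) = ∈-filterᵇ-allFin (adj G w) wy
    y∷xs⊆ (there z∈xs) = ∈-filterᵇ-allFin (adj G w) (All.lookup xs-adj z∈xs)

  -- G − {u, u₁, u₂} on the same vertex set: the three vertices become isolated
  module Deletion (u u₁ u₂ : Fin (n G)) where

    removed : List (Fin (n G))
    removed = u ∷ u₁ ∷ u₂ ∷ []

    kept : Fin (n G) → Bool
    kept x = isNo (x ∈? removed)

    kept⇒∉ : ∀ {x} → kept x ≡ true → x ∉ removed
    kept⇒∉ {x} x-kept with x ∈? removed
    ... | no x∉ = x∉

    ∉⇒kept : ∀ {x} → x ∉ removed → kept x ≡ true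
    ∉⇒kept {x} x∉ with x ∈? removed
    ... | yes x∈ = ⊥-elim (x∉ x∈)
    ... | no _ = refl

    ∈⇒¬kept : ∀ {x} → x ∈ removed → kept x ≡ false
    ∈⇒¬kept {x} x∈ with x ∈? removed
    ... | yes _ = refl
    ... | no x∉ = ⊥-elim (x∉ x∈)

    adjH : Fin (n G) → Fin (n G) → Bool
    adjH x y = adj G x y ∧ (kept x ∧ kept y)

    H : Graph
    H = record
      { n = n G ; adj = adjH
      ; sym = λ x y → cong₂ _∧_ (Graph.sym G x y) (∧-comm (kept x) (kept y))
      ; irrefl = λ x → cong (_∧ (kept x ∧ kept x)) (Graph.irrefl G x) }

    adjH⇒Adj : ∀ {x y} → adjH x y ≡ true → Adj G x y
    adjH⇒Adj {x} {y} = ∧-conicalˡ (adj G x y) _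

    adjH⇒kept : ∀ {x y} → adjH x y ≡ true → y ∉ removed
    adjH⇒kept {x} {y} xy = kept⇒∉ (∧-conicalʳ (kept x) _ (∧-conicalʳ (adj G x y) _ xy))

    Adj⇒adjH : ∀ {x y} → Adj G x y → x ∉ removed → y ∉ removed → adjH x y ≡ true
    Adj⇒adjH xy x∉ y∉ = cong₂ _∧_ xy (cong₂ _∧_ (∉⇒kept x∉) (∉⇒kept y∉))

    H-subgraph : Adj G u u₁ → Subgraph H G
    H-subgraph u-u₁ = record
      { f = λ x → x ; inj = λ x≡y → x≡y ; hom = λ _ _ → adjH⇒Adj
      ; proper = inj₂ (u , u₁ , u-u₁ , u-u₁-deleted) }
      where
      u-u₁-deleted : adjH u u₁ ≡ false
      u-u₁-deleted = trans (cong (λ b → adj G u u₁ ∧ (b ∧ kept u₁)) (∈⇒¬kept (here refl))) (∧-zeroʳ _)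

-- H = G − {u, u₁, u₂} enters only through adjH and its properties,
-- so that the configuration can be mirrored by swap.
record Configuration (G : Graph) : Set where
  field
    u u₁ u₂ v₁ v₂ v₃ : Fin (n G)
    u-u₁ : Adj G u u₁
    u-u₂ : Adj G u u₂
    u-v₃ : Adj G u v₃
    u₁-v₁ : Adj G u₁ v₁
    u₂-v₂ : Adj G u₂ v₂
    u₁≢u₂ : u₁ ≢ u₂
    u₁≢v₃ : u₁ ≢ v₃
    u₂≢v₃ : u₂ ≢ v₃
    v₁≢u : v₁ ≢ u
    v₂≢u : v₂ ≢ u
    N[u] : ∀ {y} → Adj G u y → y ∈ u₁ ∷ u₂ ∷ v₃ ∷ []
    N[u₁] : ∀ {y} → Adj G u₁ y → y ∈ u ∷ v₁ ∷ []
    N[u₂] : ∀ {y} → Adj G u₂ y → y ∈ u ∷ v₂ ∷ []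
    adjH : Fin (n G) → Fin (n G) → Bool
    adjH-sym : ∀ {x y} → adjH x y ≡ true → adjH y x ≡ true
    adjH⇒Adj : ∀ {x y} → adjH x y ≡ true → Adj G x y
    adjH⇒kept : ∀ {x y} → adjH x y ≡ true → y ∉ u ∷ u₁ ∷ u₂ ∷ []
    Adj⇒adjH : ∀ {x y} → Adj G x y → x ∉ u ∷ u₁ ∷ u₂ ∷ [] → y ∉ u ∷ u₁ ∷ u₂ ∷ [] → adjH x y ≡ true

swap : ∀ {G} → Configuration G → Configuration G
swap {G} C = record
  { u = u ; u₁ = u₂ ; u₂ = u₁ ; v₁ = v₂ ; v₂ = v₁ ; v₃ = v₃
  ; u-u₁ = u-u₂ ; u-u₂ = u-u₁ ; u-v₃ = u-v₃ ; u₁-v₁ = u₂-v₂ ; u₂-v₂ = u₁-v₁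
  ; u₁≢u₂ = ≢-sym u₁≢u₂ ; u₁≢v₃ = u₂≢v₃ ; u₂≢v₃ = u₁≢v₃ ; v₁≢u = v₂≢u ; v₂≢u = v₁≢u
  ; N[u] = ∈-resp-↭ (↭.swap u₁ u₂ ↭.refl) ∘ N[u] ; N[u₁] = N[u₂] ; N[u₂] = N[u₁]
  ; adjH = adjH ; adjH-sym = adjH-sym ; adjH⇒Adj = adjH⇒Adj
  ; adjH⇒kept = λ xy → adjH⇒kept xy ∘ ∈-resp-↭ swap₂₃
  ; Adj⇒adjH = λ xy x∉ y∉ → Adj⇒adjH xy (x∉ ∘ ∈-resp-↭ swap₂₃) (y∉ ∘ ∈-resp-↭ swap₂₃)
  }
  where
  open Configuration C
  swap₂₃ : ∀ {a b c : Fin (n G)} → a ∷ b ∷ c ∷ [] ↭ a ∷ c ∷ b ∷ []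
  swap₂₃ {a} {b} {c} = ↭.prep a (↭.swap b c ↭.refl)

configuration : ∀ G {u u₁ u₂ v₃ v₁ v₂} → deg G u ≡ 3 → Adj G u u₁ → Adj G u u₂ → Adj G u v₃ →
  u₁ ≢ u₂ → u₁ ≢ v₃ → u₂ ≢ v₃ → deg G u₁ ≡ 2 → deg G u₂ ≡ 2 →
  Adj G u₁ v₁ → v₁ ≢ u → Adj G u₂ v₂ → v₂ ≢ u → Configuration G
configuration G {u} {u₁} {u₂} {v₃} {v₁} {v₂}
  deg-u u-u₁ u-u₂ u-v₃ u₁≢u₂ u₁≢v₃ u₂≢v₃ deg-u₁ deg-u₂ u₁-v₁ v₁≢u u₂-v₂ v₂≢u =
  record
    { u = u ; u₁ = u₁ ; u₂ = u₂ ; v₁ = v₁ ; v₂ = v₂ ; v₃ = v₃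
    ; u-u₁ = u-u₁ ; u-u₂ = u-u₂ ; u-v₃ = u-v₃ ; u₁-v₁ = u₁-v₁ ; u₂-v₂ = u₂-v₂
    ; u₁≢u₂ = u₁≢u₂ ; u₁≢v₃ = u₁≢v₃ ; u₂≢v₃ = u₂≢v₃ ; v₁≢u = v₁≢u ; v₂≢u = v₂≢u
    ; N[u] = neighbours-of-degree G (u₁ ∷ u₂ ∷ v₃ ∷ []) deg-u
               ((u₁≢u₂ ∷ u₁≢v₃ ∷ []) ∷ (u₂≢v₃ ∷ []) ∷ [] ∷ []) (u-u₁ ∷ u-u₂ ∷ u-v₃ ∷ [])
    ; N[u₁] = neighbours-of-degree G (u ∷ v₁ ∷ []) deg-u₁
                ((≢-sym v₁≢u ∷ []) ∷ [] ∷ []) (Adj-sym G u-u₁ ∷ u₁-v₁ ∷ [])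
    ; N[u₂] = neighbours-of-degree G (u ∷ v₂ ∷ []) deg-u₂
                ((≢-sym v₂≢u ∷ []) ∷ [] ∷ []) (Adj-sym G u-u₂ ∷ u₂-v₂ ∷ [])
    ; adjH = adjH ; adjH-sym = Adj-sym H
    ; adjH⇒Adj = adjH⇒Adj ; adjH⇒kept = adjH⇒kept ; Adj⇒adjH = Adj⇒adjH
    }
  where open Deletion G u u₁ u₂

module Extending (k : ℕ) {G : Graph} (C : Configuration G) where
  open Configuration C public

  V : Set
  V = Fin (n G)

  AdjH : V → V → Set
  AdjH x y = adjH x y ≡ true

  removed : List V
  removed = u ∷ u₁ ∷ u₂ ∷ []

  Packing : Set
  Packing = Σ (V → Colour k) (IsPacking (Adj G))

  AdjH⇒≢ : ∀ {x y} → AdjH x y → x ≢ y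
  AdjH⇒≢ = Adj⇒≢ G ∘ adjH⇒Adj

  u≢u₁ : u ≢ u₁
  u≢u₁ = Adj⇒≢ G u-u₁

  u≢u₂ : u ≢ u₂
  u≢u₂ = Adj⇒≢ G u-u₂

  v₃-kept : v₃ ∉ removed
  v₃-kept (here v₃≡u) = Adj⇒≢ G u-v₃ (≡-sym v₃≡u)
  v₃-kept (there (here v₃≡u₁)) = u₁≢v₃ (≡-sym v₃≡u₁)
  v₃-kept (there (there (here v₃≡u₂))) = u₂≢v₃ (≡-sym v₃≡u₂)

  v₁-kept : v₁ ≢ u₂ → v₁ ∉ removed
  v₁-kept _ (here v₁≡u) = v₁≢u v₁≡u
  v₁-kept _ (there (here v₁≡u₁)) = Adj⇒≢ G u₁-v₁ (≡-sym v₁≡u₁)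
  v₁-kept v₁≢u₂ (there (there (here v₁≡u₂))) = v₁≢u₂ v₁≡u₂

  v₂-kept : v₂ ≢ u₁ → v₂ ∉ removed
  v₂-kept _ (here v₂≡u) = v₂≢u v₂≡u
  v₂-kept v₂≢u₁ (there (here v₂≡u₁)) = v₂≢u₁ v₂≡u₁
  v₂-kept _ (there (there (here v₂≡u₂))) = Adj⇒≢ G u₂-v₂ (≡-sym v₂≡u₂)

  triangle : v₁ ≡ u₂ → v₂ ≡ u₁
  triangle refl with N[u₂] (Adj-sym G u₁-v₁)
  ... | here u₁≡u = ⊥-elim (u≢u₁ (≡-sym u₁≡u))
  ... | there (here u₁≡v₂) = ≡-sym u₁≡v₂

  triangle′ : v₂ ≡ u₁ → v₁ ≡ u₂
  triangle′ refl with N[u₁] (Adj-sym G u₂-v₂)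
  ... | here u₂≡u = ⊥-elim (u≢u₂ (≡-sym u₂≡u))
  ... | there (here u₂≡v₁) = ≡-sym u₂≡v₁

  kept-N[u] : ∀ {x} → x ∉ removed → Adj G u x → x ≡ v₃
  kept-N[u] {x} x∉ ux with N[u] ux
  ... | here refl = ⊥-elim (x∉ (there (here refl)))
  ... | there (here refl) = ⊥-elim (x∉ (there (there (here refl))))
  ... | there (there (here x≡v₃)) = x≡v₃

  kept-N[u₁] : ∀ {x} → x ∉ removed → Adj G u₁ x → x ≡ v₁
  kept-N[u₁] {x} x∉ u₁x with N[u₁] u₁x
  ... | here refl = ⊥-elim (x∉ (here refl))
  ... | there (here x≡v₁) = x≡v₁

  kept-N[u₂] : ∀ {x} → x ∉ removed → Adj G u₂ x → x ≡ v₂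
  kept-N[u₂] {x} x∉ u₂x with N[u₂] u₂x
  ... | here refl = ⊥-elim (x∉ (here refl))
  ... | there (here x≡v₂) = x≡v₂

  u₁≁u₂ : v₁ ≢ u₂ → ¬ Adj G u₁ u₂
  u₁≁u₂ v₁≢u₂ u₁u₂ with N[u₁] u₁u₂
  ... | here u₂≡u = u≢u₂ (≡-sym u₂≡u)
  ... | there (here u₂≡v₁) = v₁≢u₂ (≡-sym u₂≡v₁)

  module Glue (φ : V → Colour k) (φ-packing : IsPacking AdjH φ) (cu c₁ c₂ : Colour k) where
    open DecMembership (_≟_ {n G}) using (_∈?_)

    ψ : V → Colour k
    ψ = ((φ [ u₂ ≔ c₂ ]) [ u₁ ≔ c₁ ]) [ u ≔ cu ]

    ψ-u : ψ u ≡ cu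
    ψ-u = ≔-same _ u

    ψ-u₁ : ψ u₁ ≡ c₁
    ψ-u₁ = trans (≔-other _ (≢-sym u≢u₁)) (≔-same _ u₁)

    ψ-u₂ : ψ u₂ ≡ c₂
    ψ-u₂ = trans (≔-other _ (≢-sym u≢u₂)) (trans (≔-other _ (≢-sym u₁≢u₂)) (≔-same φ u₂))

    ψ-kept : ∀ {x} → x ∉ removed → ψ x ≡ φ x
    ψ-kept x∉ = trans (≔-other _ (x∉ ∘ here))
      (trans (≔-other _ (x∉ ∘ there ∘ here)) (≔-other φ (x∉ ∘ there ∘ there ∘ here)))

    -- the conditions v₁ ≢ u₂ and v₂ ≢ u₁ exclude the triangle u u₁ u₂, where v₁, v₂ are not in H
    record Compatible : Set where
      field
        cu≢c₁ : cu ≢ c₁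
        cu≢c₂ : cu ≢ c₂
        v₃≢cu : φ v₃ ≢ cu
        v₁≢c₁ : v₁ ≢ u₂ → φ v₁ ≢ c₁
        v₂≢c₂ : v₂ ≢ u₁ → φ v₂ ≢ c₂
        c₁≢c₂ : IsTwo c₁ ⊎ IsTwo c₂ ⊎ Adj G u₁ u₂ → c₁ ≢ c₂
        two-at-u : IsTwo cu →
          (v₁ ≢ u₂ → φ v₁ ≢ cu) × (v₂ ≢ u₁ → φ v₂ ≢ cu) × (∀ y → AdjH v₃ y → φ y ≢ cu)
        two-at-u₁ : IsTwo c₁ → φ v₃ ≢ c₁ × (v₁ ≢ u₂ → ∀ y → AdjH v₁ y → φ y ≢ c₁)
        two-at-u₂ : IsTwo c₂ → φ v₃ ≢ c₂ × (v₂ ≢ u₁ → ∀ y → AdjH v₂ y → φ y ≢ c₂)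

    module _ (ok : Compatible) where
      open Compatible ok

      separated-u : ∀ {y} → u ≢ y → ψ u ≡ ψ y → Separated (Adj G) ψ u y
      separated-u {y} u≢y same with y ∈? removed
      ... | yes (here refl) = ⊥-elim (u≢y refl)
      ... | yes (there (here refl)) = ⊥-elim (cu≢c₁ (trans (≡-sym ψ-u) (trans same ψ-u₁)))
      ... | yes (there (there (here refl))) = ⊥-elim (cu≢c₂ (trans (≡-sym ψ-u) (trans same ψ-u₂)))
      ... | no y∉ = u≁y , no-common
        where
        φy≡cu : φ y ≡ cu
        φy≡cu = trans (≡-sym (ψ-kept y∉)) (trans (≡-sym same) ψ-u)
        u≁y : ¬ Adj G u y
        u≁y uy with kept-N[u] y∉ uy
        ... | refl = v₃≢cu φy≡cu
        no-common : IsTwo (ψ u) → ∀ z → Adj G u z → Adj G z y → ⊥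
        no-common two z uz zy with two-at-u (subst IsTwo ψ-u two) | N[u] uz
        ... | v₁≢cu , _ , _ | here refl with kept-N[u₁] y∉ zy
        ...   | refl = v₁≢cu (y∉ ∘ there ∘ there ∘ here) φy≡cu
        no-common two z uz zy | _ , v₂≢cu , _ | there (here refl) with kept-N[u₂] y∉ zy
        ...   | refl = v₂≢cu (y∉ ∘ there ∘ here) φy≡cu
        no-common two z uz zy | _ , _ , N[v₃]≢cu | there (there (here refl)) =
          N[v₃]≢cu y (Adj⇒adjH zy v₃-kept y∉) φy≡cu

      separated-u₁ : ∀ {y} → u₁ ≢ y → ψ u₁ ≡ ψ y → Separated (Adj G) ψ u₁ y
      separated-u₁ {y} u₁≢y same with y ∈? removed
      ... | yes (here refl) = ⊥-elim (cu≢c₁ (trans (≡-sym ψ-u) (trans (≡-sym same) ψ-u₁)))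
      ... | yes (there (here refl)) = ⊥-elim (u₁≢y refl)
      ... | yes (there (there (here refl))) =
        (λ u₁u₂ → c₁≢c₂ (inj₂ (inj₂ u₁u₂)) c₁≡c₂) ,
        (λ two _ _ _ → c₁≢c₂ (inj₁ (subst IsTwo ψ-u₁ two)) c₁≡c₂)
        where
        c₁≡c₂ : c₁ ≡ c₂
        c₁≡c₂ = trans (≡-sym ψ-u₁) (trans same ψ-u₂)
      ... | no y∉ = u₁≁y , no-common
        where
        φy≡c₁ : φ y ≡ c₁
        φy≡c₁ = trans (≡-sym (ψ-kept y∉)) (trans (≡-sym same) ψ-u₁)
        u₁≁y : ¬ Adj G u₁ y
        u₁≁y u₁y with kept-N[u₁] y∉ u₁y
        ... | refl = v₁≢c₁ (y∉ ∘ there ∘ there ∘ here) φy≡c₁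
        no-common : IsTwo (ψ u₁) → ∀ z → Adj G u₁ z → Adj G z y → ⊥
        no-common two z u₁z zy with two-at-u₁ (subst IsTwo ψ-u₁ two) | N[u₁] u₁z
        ... | v₃≢c₁ , _ | here refl with kept-N[u] y∉ zy
        ...   | refl = v₃≢c₁ φy≡c₁
        no-common two z u₁z zy | _ , N[v₁]≢c₁ | there (here refl) with v₁ ≟ u₂
        ...   | no v₁≢u₂ = N[v₁]≢c₁ v₁≢u₂ y (Adj⇒adjH zy (v₁-kept v₁≢u₂) y∉) φy≡c₁
        ...   | yes v₁≡u₂ with kept-N[u₂] y∉ (subst (λ w → Adj G w y) v₁≡u₂ zy)
        ...     | refl = y∉ (there (here (triangle v₁≡u₂)))

      separated-u₂ : ∀ {y} → u₂ ≢ y → ψ u₂ ≡ ψ y → Separated (Adj G) ψ u₂ y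
      separated-u₂ {y} u₂≢y same with y ∈? removed
      ... | yes (here refl) = ⊥-elim (cu≢c₂ (trans (≡-sym ψ-u) (trans (≡-sym same) ψ-u₂)))
      ... | yes (there (here refl)) =
        (λ u₂u₁ → c₁≢c₂ (inj₂ (inj₂ (Adj-sym G u₂u₁))) c₁≡c₂) ,
        (λ two _ _ _ → c₁≢c₂ (inj₂ (inj₁ (subst IsTwo ψ-u₂ two))) c₁≡c₂)
        where
        c₁≡c₂ : c₁ ≡ c₂
        c₁≡c₂ = trans (≡-sym ψ-u₁) (trans (≡-sym same) ψ-u₂)
      ... | yes (there (there (here refl))) = ⊥-elim (u₂≢y refl)
      ... | no y∉ = u₂≁y , no-common
        where
        φy≡c₂ : φ y ≡ c₂
        φy≡c₂ = trans (≡-sym (ψ-kept y∉)) (trans (≡-sym same) ψ-u₂)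
        u₂≁y : ¬ Adj G u₂ y
        u₂≁y u₂y with kept-N[u₂] y∉ u₂y
        ... | refl = v₂≢c₂ (y∉ ∘ there ∘ here) φy≡c₂
        no-common : IsTwo (ψ u₂) → ∀ z → Adj G u₂ z → Adj G z y → ⊥
        no-common two z u₂z zy with two-at-u₂ (subst IsTwo ψ-u₂ two) | N[u₂] u₂z
        ... | v₃≢c₂ , _ | here refl with kept-N[u] y∉ zy
        ...   | refl = v₃≢c₂ φy≡c₂
        no-common two z u₂z zy | _ , N[v₂]≢c₂ | there (here refl) with v₂ ≟ u₁
        ...   | no v₂≢u₁ = N[v₂]≢c₂ v₂≢u₁ y (Adj⇒adjH zy (v₂-kept v₂≢u₁) y∉) φy≡c₂
        ...   | yes v₂≡u₁ with kept-N[u₁] y∉ (subst (λ w → Adj G w y) v₂≡u₁ zy)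
        ...     | refl = y∉ (there (there (here (triangle′ v₂≡u₁))))

      separated-kept : ∀ {x y} → x ∉ removed → y ∉ removed → x ≢ y → ψ x ≡ ψ y → Separated (Adj G) ψ x y
      separated-kept {x} {y} x∉ y∉ x≢y same = x≁y ∘ (λ xy → Adj⇒adjH xy x∉ y∉) , no-common
        where
        φ-same : φ x ≡ φ y
        φ-same = trans (≡-sym (ψ-kept x∉)) (trans same (ψ-kept y∉))
        x≁y : ¬ AdjH x y
        x≁y = proj₁ (φ-packing x y x≢y φ-same)
        -- a removed vertex has at most one neighbour in H
        no-common : IsTwo (ψ x) → ∀ z → Adj G x z → Adj G z y → ⊥
        no-common two z xz zy with z ∈? removed
        ... | yes (here refl) = x≢y (trans (kept-N[u] x∉ (Adj-sym G xz)) (≡-sym (kept-N[u] y∉ zy)))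
        ... | yes (there (here refl)) =
          x≢y (trans (kept-N[u₁] x∉ (Adj-sym G xz)) (≡-sym (kept-N[u₁] y∉ zy)))
        ... | yes (there (there (here refl))) =
          x≢y (trans (kept-N[u₂] x∉ (Adj-sym G xz)) (≡-sym (kept-N[u₂] y∉ zy)))
        ... | no z∉ = proj₂ (φ-packing x y x≢y φ-same) (subst IsTwo (ψ-kept x∉) two) z
                        (Adj⇒adjH xz x∉ z∉) (Adj⇒adjH zy z∉ y∉)

      ψ-separated-sym : ∀ {x y} → ψ x ≡ ψ y → Separated (Adj G) ψ x y → Separated (Adj G) ψ y x
      ψ-separated-sym = Separated-sym {c = ψ} (Adj-sym G)

      ψ-isPacking : IsPacking (Adj G) ψ
      ψ-isPacking x y x≢y same with x ∈? removed | y ∈? removed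
      ... | yes (here refl) | _ = separated-u x≢y same
      ... | yes (there (here refl)) | _ = separated-u₁ x≢y same
      ... | yes (there (there (here refl))) | _ = separated-u₂ x≢y same
      ... | no _ | yes (here refl) = ψ-separated-sym (≡-sym same) (separated-u (≢-sym x≢y) (≡-sym same))
      ... | no _ | yes (there (here refl)) =
        ψ-separated-sym (≡-sym same) (separated-u₁ (≢-sym x≢y) (≡-sym same))
      ... | no _ | yes (there (there (here refl))) =
        ψ-separated-sym (≡-sym same) (separated-u₂ (≢-sym x≢y) (≡-sym same))
      ... | no x∉ | no y∉ = separated-kept x∉ y∉ x≢y same

    extend : Compatible → Packing
    extend ok = ψ , ψ-isPacking ok

  module _ (φ : V → Colour k) (φ-packing : IsPacking AdjH φ) where

    extend-one-colours : ∀ x → IsOne x → ¬ Adj G u₁ u₂ →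
      φ v₃ ≢ opp x → φ v₁ ≢ x → φ v₂ ≢ x → Packing
    extend-one-colours x x₁ u₁≁u₂ v₃≢ v₁≢ v₂≢ = extend record
      { cu≢c₁ = ≢-sym (≢-opp x) ; cu≢c₂ = ≢-sym (≢-opp x) ; v₃≢cu = v₃≢
      ; v₁≢c₁ = λ _ → v₁≢ ; v₂≢c₂ = λ _ → v₂≢
      ; c₁≢c₂ = λ { (inj₁ x₂) → ⊥-elim (isOne⇒¬isTwo x₁ x₂)
                  ; (inj₂ (inj₁ x₂)) → ⊥-elim (isOne⇒¬isTwo x₁ x₂)
                  ; (inj₂ (inj₂ u₁u₂)) → ⊥-elim (u₁≁u₂ u₁u₂) }
      ; two-at-u = ⊥-elim ∘ isOne⇒¬isTwo (opp-isOne x)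
      ; two-at-u₁ = ⊥-elim ∘ isOne⇒¬isTwo x₁ ; two-at-u₂ = ⊥-elim ∘ isOne⇒¬isTwo x₁ }
      where open Glue φ φ-packing (opp x) x x

    extend-two-at-u : ∀ d → IsTwo d → ¬ Adj G u₁ u₂ → φ v₃ ≢ d → φ v₁ ≢ d → φ v₂ ≢ d →
      (∀ y → AdjH v₃ y → φ y ≢ d) → Packing
    extend-two-at-u d d₂ u₁≁u₂ v₃≢ v₁≢ v₂≢ N[v₃]≢ = extend record
      { cu≢c₁ = isTwo-isOne-≢ d₂ (opp-isOne (φ v₁)) ; cu≢c₂ = isTwo-isOne-≢ d₂ (opp-isOne (φ v₂))
      ; v₃≢cu = v₃≢ ; v₁≢c₁ = λ _ → ≢-opp (φ v₁) ; v₂≢c₂ = λ _ → ≢-opp (φ v₂)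
      ; c₁≢c₂ = λ { (inj₁ two) → ⊥-elim (isOne⇒¬isTwo (opp-isOne (φ v₁)) two)
                  ; (inj₂ (inj₁ two)) → ⊥-elim (isOne⇒¬isTwo (opp-isOne (φ v₂)) two)
                  ; (inj₂ (inj₂ u₁u₂)) → ⊥-elim (u₁≁u₂ u₁u₂) }
      ; two-at-u = λ _ → (λ _ → v₁≢) , (λ _ → v₂≢) , N[v₃]≢
      ; two-at-u₁ = ⊥-elim ∘ isOne⇒¬isTwo (opp-isOne (φ v₁))
      ; two-at-u₂ = ⊥-elim ∘ isOne⇒¬isTwo (opp-isOne (φ v₂)) }
      where open Glue φ φ-packing d (opp (φ v₁)) (opp (φ v₂))

    extend-two-at-u₁ : ∀ x e → IsOne x → IsTwo e → φ v₃ ≢ opp x → φ v₂ ≢ x →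
      φ v₁ ≢ e → φ v₃ ≢ e → (∀ y → AdjH v₁ y → φ y ≢ e) → Packing
    extend-two-at-u₁ x e x₁ e₂ v₃≢ v₂≢ v₁≢e v₃≢e N[v₁]≢e = extend record
      { cu≢c₁ = isOne-isTwo-≢ (opp-isOne x) e₂ ; cu≢c₂ = ≢-sym (≢-opp x) ; v₃≢cu = v₃≢
      ; v₁≢c₁ = λ _ → v₁≢e ; v₂≢c₂ = λ _ → v₂≢ ; c₁≢c₂ = λ _ → isTwo-isOne-≢ e₂ x₁
      ; two-at-u = ⊥-elim ∘ isOne⇒¬isTwo (opp-isOne x)
      ; two-at-u₁ = λ _ → v₃≢e , (λ _ → N[v₁]≢e)
      ; two-at-u₂ = ⊥-elim ∘ isOne⇒¬isTwo x₁ }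
      where open Glue φ φ-packing (opp x) e x

    module _ (v₁≡u₂ : v₁ ≡ u₂) where

      extend-triangle-two-at-u₂ : ∀ x d → IsOne x → IsTwo d → φ v₃ ≢ opp x → φ v₃ ≢ d → Packing
      extend-triangle-two-at-u₂ x d x₁ d₂ v₃≢ v₃≢d = extend record
        { cu≢c₁ = ≢-sym (≢-opp x) ; cu≢c₂ = isOne-isTwo-≢ (opp-isOne x) d₂ ; v₃≢cu = v₃≢
        ; v₁≢c₁ = λ v₁≢u₂ → ⊥-elim (v₁≢u₂ v₁≡u₂) ; v₂≢c₂ = λ v₂≢u₁ → ⊥-elim (v₂≢u₁ (triangle v₁≡u₂))
        ; c₁≢c₂ = λ _ → isOne-isTwo-≢ x₁ d₂
        ; two-at-u = ⊥-elim ∘ isOne⇒¬isTwo (opp-isOne x) ; two-at-u₁ = ⊥-elim ∘ isOne⇒¬isTwo x₁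
        ; two-at-u₂ = λ _ → v₃≢d , (λ v₂≢u₁ → ⊥-elim (v₂≢u₁ (triangle v₁≡u₂))) }
        where open Glue φ φ-packing (opp x) x d

      extend-triangle-two-at-u : ∀ d → IsTwo d → φ v₃ ≢ d → (∀ y → AdjH v₃ y → φ y ≢ d) → Packing
      extend-triangle-two-at-u d d₂ v₃≢d N[v₃]≢d = extend record
        { cu≢c₁ = isTwo-isOne-≢ d₂ tt ; cu≢c₂ = isTwo-isOne-≢ d₂ tt ; v₃≢cu = v₃≢d
        ; v₁≢c₁ = λ v₁≢u₂ → ⊥-elim (v₁≢u₂ v₁≡u₂) ; v₂≢c₂ = λ v₂≢u₁ → ⊥-elim (v₂≢u₁ (triangle v₁≡u₂))
        ; c₁≢c₂ = λ _ ()
        ; two-at-u = λ _ → (λ v₁≢u₂ → ⊥-elim (v₁≢u₂ v₁≡u₂)) ,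
                           (λ v₂≢u₁ → ⊥-elim (v₂≢u₁ (triangle v₁≡u₂))) , N[v₃]≢d
        ; two-at-u₁ = λ () ; two-at-u₂ = λ () }
        where open Glue φ φ-packing d zero (suc zero)

  neighboursH : V → List V
  neighboursH v = filterᵇ (adjH v) (allFin (n G))

  degH : V → ℕ
  degH v = length (neighboursH v)

  coloursAround : (V → Colour k) → V → List (Colour k)
  coloursAround φ v = map φ (neighboursH v)

  ∈-coloursAround : ∀ φ {v y} → AdjH v y → φ y ∈ coloursAround φ v
  ∈-coloursAround φ {v} vy = ∈-map⁺ φ (∈-filterᵇ-allFin (adjH v) vy)

  ∉-coloursAround : ∀ φ {v c} → c ∉ coloursAround φ v → ∀ y → AdjH v y → φ y ≢ c
  ∉-coloursAround φ c∉ y vy refl = c∉ (∈-coloursAround φ vy)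

  ∈-coloursAround⇒≢ : ∀ {φ} → IsPacking AdjH φ → ∀ {v c} → c ∈ coloursAround φ v → φ v ≢ c
  ∈-coloursAround⇒≢ {φ} φ-packing {v} c∈ with ∈-map⁻ φ c∈
  ... | y , y∈ , refl = λ same → proj₁ (φ-packing v y (AdjH⇒≢ vy) same) vy
    where vy = ∈-filterᵇ⇒true (adjH v) (allFin (n G)) y∈

  missing-isTwo-around : ∀ φ v (ones extra : List (Colour k)) → Unique ones → All IsOne ones →
    ones ⊆ extra ++ coloursAround φ v → length extra + degH v < length ones + k →
    Σ (Colour k) λ d → IsTwo d × d ∉ extra × (∀ y → AdjH v y → φ y ≢ d)
  missing-isTwo-around φ v ones extra ones! ones₁ ones⊆ short
    with missing-isTwo ones (extra ++ coloursAround φ v) ones! ones₁ ones⊆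
           (subst (_< length ones + k) (≡-sym length-cs) short)
    where
    length-cs : length (extra ++ coloursAround φ v) ≡ length extra + degH v
    length-cs = trans (length-++ extra) (cong (length extra +_) (length-map φ (neighboursH v)))
  ... | d , d₂ , d∉ =
    d , d₂ , d∉ ∘ ∈-++⁺ˡ , λ y vy d≡ → d∉ (∈-++⁺ʳ extra (subst (_∈ _) d≡ (∈-coloursAround φ vy)))

  recolour : ∀ {φ} → IsPacking AdjH φ → ∀ w {x} → IsOne x → x ∉ coloursAround φ w →
    IsPacking AdjH (φ [ w ≔ x ])
  recolour {φ} φ-packing w x₁ x∉ = recolour-isPacking AdjH adjH-sym φ-packing w x₁ (∉-coloursAround φ x∉)

  ≔-around : ∀ (φ : V → Colour k) {w x y} → AdjH w y → (φ [ w ≔ x ]) y ≡ φ y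
  ≔-around φ wy = ≔-other φ (≢-sym (AdjH⇒≢ wy))

  ones-around⇒isTwo : ∀ {φ} → IsPacking AdjH φ → ∀ {v} →
    zero ∈ coloursAround φ v → suc zero ∈ coloursAround φ v → IsTwo (φ v)
  ones-around⇒isTwo φ-packing 0∈ 1∈ =
    ≢0∧≢1⇒isTwo _ (∈-coloursAround⇒≢ φ-packing 0∈) (∈-coloursAround⇒≢ φ-packing 1∈)

  module _ (φ : V → Colour k) (φ-packing : IsPacking AdjH φ) where

    missing-isTwo-at-v₃ : degH v₃ ≤ k → zero ∈ coloursAround φ v₃ → suc zero ∈ coloursAround φ v₃ →
      Σ (Colour k) λ d → IsTwo d × φ v₃ ≢ d × (∀ y → AdjH v₃ y → φ y ≢ d)
    missing-isTwo-at-v₃ small 0∈ 1∈ with missing-isTwo-around φ v₃ (zero ∷ suc zero ∷ []) (φ v₃ ∷ [])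
                                           (((λ ()) ∷ []) ∷ [] ∷ []) (tt ∷ tt ∷ []) ones⊆ (s≤s (s≤s small))
      where
      ones⊆ : (zero ∷ suc zero ∷ []) ⊆ φ v₃ ∷ coloursAround φ v₃
      ones⊆ (here refl) = there 0∈
      ones⊆ (there (here refl)) = there 1∈
    ... | d , d₂ , d∉ , N[v₃]≢d = d , d₂ , d∉ ∘ here ∘ ≡-sym , N[v₃]≢d

    extend-ones-around-v₃ : ¬ Adj G u₁ u₂ → degH v₃ ≤ k →
      zero ∈ coloursAround φ v₃ → suc zero ∈ coloursAround φ v₃ → Packing
    extend-ones-around-v₃ u₁≁u₂ small 0∈ 1∈ with avoidOne⊎bothOne (φ v₁) (φ v₂)
    ... | inj₁ (x , x₁ , v₁≢x , v₂≢x) =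
      extend-one-colours φ φ-packing x x₁ u₁≁u₂ (isTwo-isOne-≢ v₃₂ (opp-isOne x)) v₁≢x v₂≢x
      where
      v₃₂ : IsTwo (φ v₃)
      v₃₂ = ones-around⇒isTwo φ-packing 0∈ 1∈
    ... | inj₂ (v₁₁ , v₂₁) =
      let (d , d₂ , v₃≢d , N[v₃]≢d) = missing-isTwo-at-v₃ small 0∈ 1∈
      in extend-two-at-u φ φ-packing d d₂ u₁≁u₂ v₃≢d (isOne-isTwo-≢ v₁₁ d₂) (isOne-isTwo-≢ v₂₁ d₂) N[v₃]≢d

    extend-triangle : v₁ ≡ u₂ → Fin k → degH v₃ ≤ k → Packing
    extend-triangle v₁≡u₂ i small with missing-isOne⊎both∈ (coloursAround φ v₃)
    ... | inj₁ (x , x₁ , x∉) =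
      extend-triangle-two-at-u₂ (φ [ v₃ ≔ x ]) (recolour φ-packing v₃ x₁ x∉) v₁≡u₂ x (twoColour i) x₁ tt
        (≡-≢-trans (≔-same φ v₃) (≢-opp x)) (≡-≢-trans (≔-same φ v₃) (isOne-isTwo-≢ x₁ tt))
    ... | inj₂ (0∈ , 1∈) =
      let (d , d₂ , v₃≢d , N[v₃]≢d) = missing-isTwo-at-v₃ small 0∈ 1∈
      in extend-triangle-two-at-u φ φ-packing v₁≡u₂ d d₂ v₃≢d N[v₃]≢d

  module _ (v₁≡v₃ : v₁ ≡ v₃) where
    private
      u₁≁u₂′ : ¬ Adj G u₁ u₂
      u₁≁u₂′ = u₁≁u₂ (λ v₁≡u₂ → u₂≢v₃ (trans (≡-sym v₁≡u₂) v₁≡v₃))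

    extend-v₁≡v₃-one-at-v₃ : ∀ φ → IsPacking AdjH φ → ∀ x d → IsOne x → IsTwo d → φ v₃ ≡ x →
      (∀ y → AdjH v₃ y → φ y ≢ d) → Packing
    extend-v₁≡v₃-one-at-v₃ φ φ-packing x d x₁ d₂ v₃↦x N[v₃]≢d = by-colour-of-v₂ (φ v₂ ≟ x)
      where
      x≢d : x ≢ d
      x≢d = isOne-isTwo-≢ x₁ d₂
      v₁↦x : φ v₁ ≡ x
      v₁↦x = trans (cong φ v₁≡v₃) v₃↦x
      by-colour-of-v₂ : Dec (φ v₂ ≡ x) → Packing
      by-colour-of-v₂ (yes v₂↦x) = extend-two-at-u φ φ-packing d d₂ u₁≁u₂′
        (≡-≢-trans v₃↦x x≢d) (≡-≢-trans v₁↦x x≢d) (≡-≢-trans v₂↦x x≢d) N[v₃]≢d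
      by-colour-of-v₂ (no v₂↦̸x) = extend-two-at-u₁ φ φ-packing x d x₁ d₂ (≡-≢-trans v₃↦x (≢-opp x)) v₂↦̸x
        (≡-≢-trans v₁↦x x≢d) (≡-≢-trans v₃↦x x≢d)
        (subst (λ w → ∀ y → AdjH w y → φ y ≢ d) (≡-sym v₁≡v₃) N[v₃]≢d)

    extend-v₁≡v₃ : degH v₃ < k → ∀ φ → IsPacking AdjH φ → Packing
    extend-v₁≡v₃ short φ φ-packing with missing-isOne⊎both∈ (coloursAround φ v₃)
    ... | inj₂ (0∈ , 1∈) = extend-ones-around-v₃ φ φ-packing u₁≁u₂′ (<⇒≤ short) 0∈ 1∈
    ... | inj₁ (x , x₁ , x∉) =
      let (d , d₂ , _ , N[v₃]≢d) = missing-isTwo-around φ v₃ [] [] [] [] (λ ()) short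
      in extend-v₁≡v₃-one-at-v₃ (φ [ v₃ ≔ x ]) (recolour φ-packing v₃ x₁ x∉) x d x₁ d₂ (≔-same φ v₃)
           (λ y v₃y → ≡-≢-trans (≔-around φ v₃y) (N[v₃]≢d y v₃y))

  module Generic (v₁≢u₂ : v₁ ≢ u₂) (v₁≢v₃ : v₁ ≢ v₃) (v₂≢v₃ : v₂ ≢ v₃) where
    open DecMembership (_≟_ {2 + k}) using (_∈?_)

    extend-recolouring-v₃ : ∀ φ → IsPacking AdjH φ → ∀ x → IsOne x → x ∉ coloursAround φ v₃ →
      φ v₁ ≢ x → φ v₂ ≢ x → Packing
    extend-recolouring-v₃ φ φ-packing x x₁ x∉ v₁↦̸x v₂↦̸x =
      extend-one-colours (φ [ v₃ ≔ x ]) (recolour φ-packing v₃ x₁ x∉) x x₁ (u₁≁u₂ v₁≢u₂)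
        (≡-≢-trans (≔-same φ v₃) (≢-opp x))
        (≡-≢-trans (≔-other φ v₁≢v₃) v₁↦̸x) (≡-≢-trans (≔-other φ v₂≢v₃) v₂↦̸x)

    extend-two-at-u-recolouring-v₃ : ∀ φ → IsPacking AdjH φ → ∀ x d → IsOne x → IsTwo d →
      x ∉ coloursAround φ v₃ → φ v₁ ≢ d → φ v₂ ≢ d → (∀ y → AdjH v₃ y → φ y ≢ d) → Packing
    extend-two-at-u-recolouring-v₃ φ φ-packing x d x₁ d₂ x∉ v₁↦̸d v₂↦̸d N[v₃]≢d =
      extend-two-at-u (φ [ v₃ ≔ x ]) (recolour φ-packing v₃ x₁ x∉) d d₂ (u₁≁u₂ v₁≢u₂)
        (≡-≢-trans (≔-same φ v₃) (isOne-isTwo-≢ x₁ d₂))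
        (≡-≢-trans (≔-other φ v₁≢v₃) v₁↦̸d) (≡-≢-trans (≔-other φ v₂≢v₃) v₂↦̸d)
        (λ y v₃y → ≡-≢-trans (≔-around φ v₃y) (N[v₃]≢d y v₃y))

    extend-small-v₃ : degH v₃ < k → ∀ φ → IsPacking AdjH φ → Packing
    extend-small-v₃ short φ φ-packing with missing-isOne⊎both∈ (coloursAround φ v₃)
    ... | inj₂ (0∈ , 1∈) = extend-ones-around-v₃ φ φ-packing (u₁≁u₂ v₁≢u₂) (<⇒≤ short) 0∈ 1∈
    ... | inj₁ (x , x₁ , x∉) with x ∈? (φ v₁ ∷ φ v₂ ∷ [])
    ...   | no x∉ends =
      extend-recolouring-v₃ φ φ-packing x x₁ x∉ (x∉ends ∘ here ∘ ≡-sym) (x∉ends ∘ there ∘ here ∘ ≡-sym)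
    ...   | yes x∈ends with opp x ∈? (φ v₁ ∷ φ v₂ ∷ coloursAround φ v₃)
    ...     | no opp∉ = extend-recolouring-v₃ φ φ-packing (opp x) (opp-isOne x) (opp∉ ∘ there ∘ there)
                          (opp∉ ∘ here ∘ ≡-sym) (opp∉ ∘ there ∘ here ∘ ≡-sym)
    ...     | yes opp∈ =
      let (d , d₂ , d∉ends , N[v₃]≢d) =
            missing-isTwo-around φ v₃ (x ∷ opp x ∷ []) (φ v₁ ∷ φ v₂ ∷ [])
              ((≢-opp x ∷ []) ∷ [] ∷ []) (x₁ ∷ opp-isOne x ∷ []) ones⊆ (s≤s (s≤s short))
      in extend-two-at-u-recolouring-v₃ φ φ-packing x d x₁ d₂ x∉
           (d∉ends ∘ here ∘ ≡-sym) (d∉ends ∘ there ∘ here ∘ ≡-sym) N[v₃]≢d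
      where
      ones⊆ : (x ∷ opp x ∷ []) ⊆ φ v₁ ∷ φ v₂ ∷ coloursAround φ v₃
      ones⊆ (here refl) = ∈-++⁺ˡ x∈ends
      ones⊆ (there (here refl)) = opp∈

    extend-free-colour-on-v₁ : degH v₁ ≤ k → ∀ φ → IsPacking AdjH φ → ∀ x → IsOne x →
      x ∉ coloursAround φ v₃ → φ v₁ ≡ x → φ v₂ ≢ x → Packing
    extend-free-colour-on-v₁ small₁ φ φ-packing x x₁ x∉ v₁↦x v₂↦̸x =
      after-recolouring (φ [ v₃ ≔ x ]) (recolour φ-packing v₃ x₁ x∉) (≔-same φ v₃)
        (trans (≔-other φ v₁≢v₃) v₁↦x) (≡-≢-trans (≔-other φ v₂≢v₃) v₂↦̸x)
      where
      after-recolouring : ∀ φ₁ → IsPacking AdjH φ₁ → φ₁ v₃ ≡ x → φ₁ v₁ ≡ x → φ₁ v₂ ≢ x → Packing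
      after-recolouring φ₁ φ₁-packing v₃↦x v₁↦x v₂↦̸x with opp x ∈? coloursAround φ₁ v₁
      ... | no opp∉ =
        extend-one-colours (φ₁ [ v₁ ≔ opp x ]) (recolour φ₁-packing v₁ (opp-isOne x) opp∉) x x₁
          (u₁≁u₂ v₁≢u₂)
          (≡-≢-trans (trans (≔-other φ₁ (≢-sym v₁≢v₃)) v₃↦x) (≢-opp x))
          (≡-≢-trans (≔-same φ₁ v₁) (≢-sym (≢-opp x)))
          (≡-≢-trans (≔-other φ₁ (λ { refl → v₂↦̸x v₁↦x })) v₂↦̸x)
      ... | yes opp∈ =
        let (e , e₂ , _ , N[v₁]≢e) = missing-isTwo-around φ₁ v₁ (opp x ∷ []) [] ([] ∷ [])
                                       (opp-isOne x ∷ []) (λ { (here refl) → opp∈ }) (s≤s small₁)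
        in extend-two-at-u₁ φ₁ φ₁-packing x e x₁ e₂ (≡-≢-trans v₃↦x (≢-opp x)) v₂↦̸x
             (≡-≢-trans v₁↦x (isOne-isTwo-≢ x₁ e₂)) (≡-≢-trans v₃↦x (isOne-isTwo-≢ x₁ e₂)) N[v₁]≢e

    extend-free-colour-on-v₁-v₂ : degH v₃ ≤ k → ∀ φ → IsPacking AdjH φ → ∀ x → IsOne x →
      x ∉ coloursAround φ v₃ → φ v₁ ≡ x → φ v₂ ≡ x → Packing
    extend-free-colour-on-v₁-v₂ small₃ φ φ-packing x x₁ x∉ v₁↦x v₂↦x with opp x ∈? coloursAround φ v₃
    ... | no opp∉ = extend-recolouring-v₃ φ φ-packing (opp x) (opp-isOne x) opp∉
                      (≡-≢-trans v₁↦x (≢-opp x)) (≡-≢-trans v₂↦x (≢-opp x))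
    ... | yes opp∈ =
      let (d , d₂ , _ , N[v₃]≢d) = missing-isTwo-around φ v₃ (opp x ∷ []) [] ([] ∷ [])
                                     (opp-isOne x ∷ []) (λ { (here refl) → opp∈ }) (s≤s small₃)
      in extend-two-at-u-recolouring-v₃ φ φ-packing x d x₁ d₂ x∉
           (≡-≢-trans v₁↦x (isOne-isTwo-≢ x₁ d₂)) (≡-≢-trans v₂↦x (isOne-isTwo-≢ x₁ d₂)) N[v₃]≢d

  degH-bound : ∀ v (D : List V) → Unique D → All (Adj G v) D → All (_∈ removed) D →
    length D + degH v ≤ deg G v
  degH-bound v D D! D-adj D-removed =
    subst (_≤ deg G v) (length-++ D) (length-≤-⊆ _≟_ (Unique.++⁺ D! N-unique disjoint) D++N⊆)
    where
    N-unique : Unique (neighboursH v)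
    N-unique = Unique.filter⁺ (T? ∘ adjH v) (Unique.allFin⁺ (n G))
    disjoint : Disjoint D (neighboursH v)
    disjoint (y∈D , y∈N) = adjH⇒kept (∈-filterᵇ⇒true (adjH v) (allFin (n G)) y∈N) (All.lookup D-removed y∈D)
    D++N⊆ : (D ++ neighboursH v) ⊆ neighbours G v
    D++N⊆ y∈ with ∈-++⁻ D y∈
    ... | inj₁ y∈D = ∈-filterᵇ-allFin (adj G v) (All.lookup D-adj y∈D)
    ... | inj₂ y∈N = ∈-filterᵇ-allFin (adj G v) (adjH⇒Adj (∈-filterᵇ⇒true (adjH v) (allFin (n G)) y∈N))

  degH<deg-v₃ : degH v₃ < deg G v₃
  degH<deg-v₃ = degH-bound v₃ (u ∷ []) ([] ∷ []) (Adj-sym G u-v₃ ∷ []) (here refl ∷ [])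

  degH<deg-v₁ : degH v₁ < deg G v₁
  degH<deg-v₁ = degH-bound v₁ (u₁ ∷ []) ([] ∷ []) (Adj-sym G u₁-v₁ ∷ []) (there (here refl) ∷ [])

  degH+2≤deg-v₃ : v₁ ≡ v₃ → 2 + degH v₃ ≤ deg G v₃
  degH+2≤deg-v₃ v₁≡v₃ = degH-bound v₃ (u ∷ u₁ ∷ []) ((u≢u₁ ∷ []) ∷ [] ∷ [])
    (Adj-sym G u-v₃ ∷ Adj-sym G (subst (Adj G u₁) v₁≡v₃ u₁-v₁) ∷ []) (here refl ∷ there (here refl) ∷ [])

module Cases (k : ℕ) {G : Graph} (C : Configuration G) where
  open Extending k C public
  private module Mirror = Extending k (swap C)

  extend-small-v₁v₂v₃ : v₁ ≢ u₂ → v₁ ≢ v₃ → v₂ ≢ v₃ → degH v₁ ≤ k → degH v₂ ≤ k → degH v₃ ≤ k →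
    ∀ φ → IsPacking AdjH φ → Packing
  extend-small-v₁v₂v₃ v₁≢u₂ v₁≢v₃ v₂≢v₃ small₁ small₂ small₃ φ φ-packing
    with missing-isOne⊎both∈ (coloursAround φ v₃)
  ... | inj₂ (0∈ , 1∈) = extend-ones-around-v₃ φ φ-packing (u₁≁u₂ v₁≢u₂) small₃ 0∈ 1∈
  ... | inj₁ (x , x₁ , x∉) with φ v₁ ≟ x | φ v₂ ≟ x
  ...   | no v₁↦̸x | no v₂↦̸x =
    Generic.extend-recolouring-v₃ v₁≢u₂ v₁≢v₃ v₂≢v₃ φ φ-packing x x₁ x∉ v₁↦̸x v₂↦̸x
  ...   | yes v₁↦x | no v₂↦̸x =
    Generic.extend-free-colour-on-v₁ v₁≢u₂ v₁≢v₃ v₂≢v₃ small₁ φ φ-packing x x₁ x∉ v₁↦x v₂↦̸x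
  ...   | no v₁↦̸x | yes v₂↦x =
    Mirror.Generic.extend-free-colour-on-v₁ (v₁≢u₂ ∘ triangle′) v₂≢v₃ v₁≢v₃ small₂
      φ φ-packing x x₁ x∉ v₂↦x v₁↦̸x
  ...   | yes v₁↦x | yes v₂↦x =
    Generic.extend-free-colour-on-v₁-v₂ v₁≢u₂ v₁≢v₃ v₂≢v₃ small₃ φ φ-packing x x₁ x∉ v₁↦x v₂↦x

  extend-by-position : Fin k → deg G v₃ ≤ suc k → ∀ φ → IsPacking AdjH φ →
    (v₁ ≢ u₂ → v₁ ≢ v₃ → v₂ ≢ v₃ → Packing) → Packing
  extend-by-position i small₃ φ φ-packing generic with v₁ ≟ u₂ | v₁ ≟ v₃ | v₂ ≟ v₃
  ... | yes v₁≡u₂ | _ | _ = extend-triangle φ φ-packing v₁≡u₂ i (s≤s⁻¹ (≤-trans degH<deg-v₃ small₃))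
  ... | no _ | yes v₁≡v₃ | _ = extend-v₁≡v₃ v₁≡v₃ (s≤s⁻¹ (≤-trans (degH+2≤deg-v₃ v₁≡v₃) small₃)) φ φ-packing
  ... | no _ | no _ | yes v₂≡v₃ =
    Mirror.extend-v₁≡v₃ v₂≡v₃ (s≤s⁻¹ (≤-trans (Mirror.degH+2≤deg-v₃ v₂≡v₃) small₃)) φ φ-packing
  ... | no v₁≢u₂ | no v₁≢v₃ | no v₂≢v₃ = generic v₁≢u₂ v₁≢v₃ v₂≢v₃

  extend-if-v₃-small : Fin k → deg G v₃ ≤ k → ∀ φ → IsPacking AdjH φ → Packing
  extend-if-v₃-small i small₃ φ φ-packing =
    extend-by-position i (≤-trans small₃ (n≤1+n k)) φ φ-packing λ v₁≢u₂ v₁≢v₃ v₂≢v₃ →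
      Generic.extend-small-v₃ v₁≢u₂ v₁≢v₃ v₂≢v₃ (≤-trans degH<deg-v₃ small₃) φ φ-packing

  extend-if-all-small : Fin k → deg G v₁ ≤ suc k → deg G v₂ ≤ suc k → deg G v₃ ≤ suc k →
    ∀ φ → IsPacking AdjH φ → Packing
  extend-if-all-small i small₁ small₂ small₃ φ φ-packing =
    extend-by-position i small₃ φ φ-packing λ v₁≢u₂ v₁≢v₃ v₂≢v₃ →
      extend-small-v₁v₂v₃ v₁≢u₂ v₁≢v₃ v₂≢v₃ (s≤s⁻¹ (≤-trans degH<deg-v₁ small₁))
        (s≤s⁻¹ (≤-trans Mirror.degH<deg-v₁ small₂)) (s≤s⁻¹ (≤-trans degH<deg-v₃ small₃)) φ φ-packing

lemma3p6 : (k : ℕ) → 1 ≤ k → (G : Graph) → Critical 2 k G →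
    (u u₁ u₂ v₃ v₁ v₂ : Fin (n G)) →
    deg G u ≡ 3 → Adj G u u₁ → Adj G u u₂ → Adj G u v₃ →
    u₁ ≢ u₂ → u₁ ≢ v₃ → u₂ ≢ v₃ →
    deg G u₁ ≡ 2 → deg G u₂ ≡ 2 →
    Adj G u₁ v₁ → v₁ ≢ u → Adj G u₂ v₂ → v₂ ≢ u →
    (deg G v₃ ≥ k + 1) × (deg G v₁ ≥ k + 2 ⊎ deg G v₂ ≥ k + 2 ⊎ deg G v₃ ≥ k + 2)
lemma3p6 k k≥1 G (uncolourable , subgraphs-colourable) u u₁ u₂ v₃ v₁ v₂
         deg-u u-u₁ u-u₂ u-v₃ u₁≢u₂ u₁≢v₃ u₂≢v₃ deg-u₁ deg-u₂ u₁-v₁ v₁≢u u₂-v₂ v₂≢u =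
  decidable-stable (k + 1 ≤? deg G v₃)
    (λ v₃-small → impossible (extend-if-v₃-small i (≰⇒≤ 0 v₃-small) φ φ-packing)) ,
  decidable-stable (k + 2 ≤? deg G v₁ ⊎-dec (k + 2 ≤? deg G v₂ ⊎-dec k + 2 ≤? deg G v₃))
    (λ none-large → impossible (extend-if-all-small i
      (≰⇒≤ 1 (none-large ∘ inj₁)) (≰⇒≤ 1 (none-large ∘ inj₂ ∘ inj₁)) (≰⇒≤ 1 (none-large ∘ inj₂ ∘ inj₂))
      φ φ-packing))
  where
  open Deletion G u u₁ u₂ using (H; H-subgraph)
  open Cases k (configuration G deg-u u-u₁ u-u₂ u-v₃ u₁≢u₂ u₁≢v₃ u₂≢v₃ deg-u₁ deg-u₂ u₁-v₁ v₁≢u u₂-v₂ v₂≢u)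
    using (Packing; extend-if-v₃-small; extend-if-all-small)
  i : Fin k
  i = fromℕ< k≥1
  H-colouring : PackingColoring 2 k H
  H-colouring = subgraphs-colourable H (H-subgraph u-u₁)
  φ : Fin (n G) → Colour k
  φ = proj₁ H-colouring
  φ-packing : IsPacking (Adj H) φ
  φ-packing = packingColoring⇒isPacking H H-colouring
  impossible : Packing → ⊥
  impossible (ψ , ψ-packing) = uncolourable (isPacking⇒packingColoring G ψ ψ-packing)
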